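{- For all integers $n\ge 0$ and $r\ge 0$, \[ B_{n,r}^{L}=\sum_{k=0}^{n}(-1)^{n-k}S_{1}(n,k)\,B_{k,2r} \qquad\text{and}\qquad B_{n,2r}=\sum_{k=0}^{n}(-1)^{n-k}S_{2}(n,k)\,B_{k,r}^{L}. \]
   Context: For a nonnegative integer $r$ and integers $0\le k\le n$, the $r$-Lah number $L_r(n,k)$ is the number of partitions of a set with $n+r$ elements into $k+r$ non-empty linearly ordered subsets such that $r$ distinguished elements lie in distinct subsets; its exponential generating function is $\sum_{n\ge k}L_r(n,k)\frac{t^n}{n!}=\frac{1}{k!}\left(\frac{1}{1-t}-1\right)^k\left(\frac{1}{1-t}\right)^{2r}$. The $r$-extended Lah-Bell number is $B^L_{n,r}=\sum_{k=0}^n L_r(n,k)$. The $r$-extended Bell numbers $B_{n,r}$ are defined by $e^{e^t-1+rt}=\sum_{n\ge0}B_{n,r}\frac{t^n}{n!}$. The (signed) Stirling numbers of the first kind $S_1(n,k)$ are defined by $(x)_n=\sum_{k=0}^nS_1(n,k)x^k$, where $(x)_n=x(x-1)\cdots(x-n+1)$, and the Stirling numbers of the second kind $S_2(n,k)$ by $x^n=\sum_{k=0}^nS_2(n,k)(x)_k$. -}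

module Defs where

open import Data.Nat as ℕ using (ℕ; zero; suc)
open import Data.Bool using (if_then_else_)
open import Data.Nat.Combinatorics using (_C_)
open import Data.Integer using (ℤ; +_; _+_; _-_; _*_; -_)
open import Data.Integer using () renaming (_^_ to _^ℤ_)

sumTo : ℕ → (ℕ → ℤ) → ℤ
sumTo zero    f = f 0
sumTo (suc n) f = sumTo n f + f (suc n)

sign : ℕ → ℤ
sign m = (- + 1) ^ℤ m

-- Signed Stirling numbers of the first kind: (x)_n = Σ_k S1(n,k) x^k,
-- equivalently S1(0,0)=1, S1(0,k+1)=0, S1(n+1,0)=0,
-- S1(n+1,k+1) = S1(n,k) - n·S1(n,k+1).
S1 : ℕ → ℕ → ℤ
S1 zero    zero    = + 1
S1 zero    (suc k) = + 0
S1 (suc n) zero    = + 0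
S1 (suc n) (suc k) = S1 n k - (+ n) * S1 n (suc k)

-- Stirling numbers of the second kind: x^n = Σ_k S2(n,k) (x)_k,
-- equivalently S2(n+1,k+1) = S2(n,k) + (k+1)·S2(n,k+1).
S2 : ℕ → ℕ → ℤ
S2 zero    zero    = + 1
S2 zero    (suc k) = + 0
S2 (suc n) zero    = + 0
S2 (suc n) (suc k) = S2 n k + (+ suc k) * S2 n (suc k)

-- r-Lah numbers L_r(n,k) (r given first), via the standard recurrence
-- equivalent to the EGF (1/k!)(1/(1-t)-1)^k (1-t)^{-2r}:
-- L_r(0,0)=1, L_r(0,k+1)=0,
-- L_r(n+1,0) = (n+2r) L_r(n,0),
-- L_r(n+1,k+1) = L_r(n,k) + (n+k+1+2r) L_r(n,k+1).
Lah : ℕ → ℕ → ℕ → ℤ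
Lah r zero    zero    = + 1
Lah r zero    (suc k) = + 0
Lah r (suc n) zero    = (+ (n ℕ.+ 2 ℕ.* r)) * Lah r n zero
Lah r (suc n) (suc k) = Lah r n k + (+ (n ℕ.+ suc k ℕ.+ 2 ℕ.* r)) * Lah r n (suc k)

LahBell : ℕ → ℕ → ℤ
LahBell n r = sumTo n (Lah r n)

-- r-extended Bell numbers B_{n,r}, EGF F(t) = e^{e^t - 1 + r t}.
-- Since F' = (e^t + r) F, the coefficients satisfy
-- B_{0,r} = 1, B_{n+1,r} = r B_{n,r} + Σ_{j=0}^n C(n,j) B_{j,r}.
-- Defined via an auxiliary table of all earlier values.
-- bellUpTo r n i = B_{i,r} for i ≤ n (values for i > n are not used)
bellUpTo : ℕ → ℕ → (ℕ → ℤ)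
bellUpTo r zero    i = + 1
bellUpTo r (suc n) i =
  if i ℕ.≤ᵇ n
  then bellUpTo r n i
  else (+ r) * bellUpTo r n n + sumTo n (λ j → (+ (n C j)) * bellUpTo r n j)

Bell : ℕ → ℕ → ℤ
Bell n r = bellUpTo r n n

-- All arrays involved are lower triangular and obey a recurrence of the shape
--   a(0,k) = δ_{0k},   a(n+1,k) = a(n,k-1) + α(n,k) a(n,k),
-- which determines a from the weight α.  If a and b have this shape with weights
-- α and β, and α(n,k) + β(k,j) = γ(n,j) does not depend on k, then the matrix
-- product a·b has it with weight γ.  With T(n,k) = {n+2r, k+2r}_{2r} the r-Stirling
-- numbers of the second kind (weight k+2r), this gives L_r = |S1|·T (weights n and
-- k+2r add up to the Lah weight n+k+2r) and T = ((-1)^{n-k} S2)·L_r (weights -k and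
-- k+j+2r add up to j+2r).  Taking row sums yields both identities, because the row
-- sums of T are the Bell numbers B_{n,2r}: the binomial transform of the r-Stirling
-- triangle for s is the one for s+1, from which the row sums inherit the recurrence
-- B_{n+1,s} = s B_{n,s} + Σ_i C(n,i) B_{i,s}.

module Submission where

open import Defs
open import Data.Nat using (ℕ; _∸_) renaming (_*_ to _*ℕ_)
open import Data.Integer using (_*_)
open import Data.Product using (_×_)
open import Relation.Binary.PropositionalEquality using (_≡_)

open import Data.Bool using (false)
open import Data.Bool.Properties using (T-≡)
open import Function.Bundles using (Equivalence)
open import Data.Integer using (ℤ; +_; _+_; -_)
import Data.Integer.Properties as ℤₚ
open import Data.Integer.Tactic.RingSolver using (solve-∀)
open import Data.Nat as ℕ using (zero; suc; _≤_; _<_; z≤n; s≤s)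
open import Data.Nat.Combinatorics using (_C_; nCk+nC[k+1]≡[n+1]C[k+1])
import Data.Nat.Properties as ℕₚ
open import Data.Product using (_,_)
open import Data.Sum using (inj₁; inj₂)
open import Relation.Binary.PropositionalEquality
  using (refl; sym; trans; cong; cong₂; module ≡-Reasoning)
open ≡-Reasoning

private
  variable
    f g : ℕ → ℤ
    α β γ a b : ℕ → ℕ → ℤ

sumTo-cong : ∀ n → (∀ k → f k ≡ g k) → sumTo n f ≡ sumTo n g
sumTo-cong zero    f≡g = f≡g 0
sumTo-cong (suc n) f≡g = cong₂ _+_ (sumTo-cong n f≡g) (f≡g (suc n))

sumTo-cong-≤ : ∀ n → (∀ {k} → k ≤ n → f k ≡ g k) → sumTo n f ≡ sumTo n g
sumTo-cong-≤ zero    f≡g = f≡g z≤n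
sumTo-cong-≤ (suc n) f≡g =
  cong₂ _+_ (sumTo-cong-≤ n (λ k≤n → f≡g (ℕₚ.m≤n⇒m≤1+n k≤n))) (f≡g ℕₚ.≤-refl)

sumTo-zero : ∀ n → (∀ k → f k ≡ + 0) → sumTo n f ≡ + 0
sumTo-zero zero    f≡0 = f≡0 0
sumTo-zero (suc n) f≡0 = cong₂ _+_ (sumTo-zero n f≡0) (f≡0 (suc n))

sumTo-+ : ∀ n (f g : ℕ → ℤ) → sumTo n (λ k → f k + g k) ≡ sumTo n f + sumTo n g
sumTo-+ zero    f g = refl
sumTo-+ (suc n) f g = trans (cong (_+ (f (suc n) + g (suc n))) (sumTo-+ n f g))
                            (interchange (sumTo n f) (sumTo n g) (f (suc n)) (g (suc n)))
  where
  interchange : ∀ (w x y z : ℤ) → (w + x) + (y + z) ≡ (w + y) + (x + z)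
  interchange = solve-∀

sumTo-*ˡ : ∀ n c (f : ℕ → ℤ) → sumTo n (λ k → c * f k) ≡ c * sumTo n f
sumTo-*ˡ zero    c f = refl
sumTo-*ˡ (suc n) c f =
  trans (cong (_+ c * f (suc n)) (sumTo-*ˡ n c f)) (sym (ℤₚ.*-distribˡ-+ c _ _))

sumTo-shift : ∀ n (f : ℕ → ℤ) → sumTo (suc n) f ≡ f 0 + sumTo n (λ k → f (suc k))
sumTo-shift zero    f = refl
sumTo-shift (suc n) f =
  trans (cong (_+ f (suc (suc n))) (sumTo-shift n f)) (ℤₚ.+-assoc (f 0) _ _)

sumTo-swap : ∀ m n (f : ℕ → ℕ → ℤ) →
  sumTo m (λ i → sumTo n (f i)) ≡ sumTo n (λ j → sumTo m (λ i → f i j))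
sumTo-swap zero    n f = refl
sumTo-swap (suc m) n f =
  trans (cong (_+ sumTo n (f (suc m))) (sumTo-swap m n f))
        (sym (sumTo-+ n (λ j → sumTo m (λ i → f i j)) (f (suc m))))

sumTo-unshift : ∀ n → f 0 ≡ + 0 → f (suc n) ≡ + 0 → sumTo n (λ k → f (suc k)) ≡ sumTo n f
sumTo-unshift {f} n f₀≡0 fₙ₊₁≡0 = begin
  sumTo n (λ k → f (suc k))             ≡⟨ sym (ℤₚ.+-identityˡ _) ⟩
  + 0 + sumTo n (λ k → f (suc k))       ≡⟨ cong (_+ sumTo n (λ k → f (suc k))) (sym f₀≡0) ⟩
  f 0 + sumTo n (λ k → f (suc k))       ≡⟨ sym (sumTo-shift n f) ⟩
  sumTo n f + f (suc n)                 ≡⟨ cong (_+_ (sumTo n f)) fₙ₊₁≡0 ⟩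
  sumTo n f + + 0                       ≡⟨ ℤₚ.+-identityʳ (sumTo n f) ⟩
  sumTo n f                             ∎

sumTo-extend : ∀ {m} n → m ≤ n → (∀ {k} → m < k → f k ≡ + 0) → sumTo n f ≡ sumTo m f
sumTo-extend zero z≤n _ = refl
sumTo-extend {f = f} {m} (suc n) m≤1+n f≡0 with ℕₚ.m≤n⇒m<n∨m≡n m≤1+n
... | inj₁ (s≤s m≤n) = trans (cong₂ _+_ (sumTo-extend n m≤n f≡0) (f≡0 (s≤s m≤n)))
                             (ℤₚ.+-identityʳ (sumTo m f))
... | inj₂ refl      = refl

δ₀ : ℕ → ℤ
δ₀ zero    = + 1
δ₀ (suc _) = + 0

prev : (ℕ → ℤ) → ℕ → ℤ
prev f zero    = + 0
prev f (suc k) = f k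

prev-cong : (∀ k → f k ≡ g k) → ∀ k → prev f k ≡ prev g k
prev-cong f≡g zero    = refl
prev-cong f≡g (suc k) = f≡g k

rowSum : (ℕ → ℕ → ℤ) → ℕ → ℤ
rowSum a n = sumTo n (a n)

infixl 7 _⊙_
_⊙_ : (ℕ → ℕ → ℤ) → (ℕ → ℕ → ℤ) → ℕ → ℕ → ℤ
(a ⊙ b) n j = sumTo n (λ k → a n k * b k j)

LowerTriangular : (ℕ → ℕ → ℤ) → Set
LowerTriangular a = ∀ {n k} → n < k → a n k ≡ + 0

record Recurrent (α a : ℕ → ℕ → ℤ) : Set where
  field
    initial : ∀ k → a 0 k ≡ δ₀ k
    step    : ∀ n k → a (suc n) k ≡ prev (a n) k + α n k * a n k

open Recurrent

recurrent⇒lowerTriangular : Recurrent α a → LowerTriangular a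
recurrent⇒lowerTriangular rec {zero}  {suc k} _ = initial rec (suc k)
recurrent⇒lowerTriangular {α} rec {suc n} {suc k} (s≤s n<k) =
  trans (step rec n (suc k))
        (cong₂ _+_ (recurrent⇒lowerTriangular rec n<k)
                   (trans (cong (α n (suc k) *_) (recurrent⇒lowerTriangular rec (ℕₚ.m<n⇒m<1+n n<k)))
                          (ℤₚ.*-zeroʳ (α n (suc k)))))

recurrent-unique : Recurrent α a → Recurrent α b → ∀ n k → a n k ≡ b n k
recurrent-unique ra rb zero    k = trans (initial ra k) (sym (initial rb k))
recurrent-unique {α} ra rb (suc n) k =
  trans (step ra n k)
        (trans (cong₂ (λ x y → x + α n k * y) (prev-cong ih k) (ih k)) (sym (step rb n k)))
  where
  ih = recurrent-unique ra rb n

recurrent-rowSum-suc : Recurrent α a → ∀ n →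
  rowSum a (suc n) ≡ rowSum a n + sumTo n (λ k → α n k * a n k)
recurrent-rowSum-suc {α} {a} rec n = begin
  sumTo (suc n) (a (suc n))
    ≡⟨ sumTo-cong (suc n) (step rec n) ⟩
  sumTo (suc n) (λ k → prev (a n) k + α n k * a n k)
    ≡⟨ sumTo-+ (suc n) (prev (a n)) (λ k → α n k * a n k) ⟩
  sumTo (suc n) (prev (a n)) + sumTo (suc n) (λ k → α n k * a n k)
    ≡⟨ cong₂ _+_ (trans (sumTo-shift n (prev (a n))) (ℤₚ.+-identityˡ (rowSum a n)))
                 (sumTo-extend (suc n) (ℕₚ.n≤1+n n) (λ {k} n<k →
                   trans (cong (α n k *_) (recurrent⇒lowerTriangular rec n<k)) (ℤₚ.*-zeroʳ (α n k)))) ⟩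
  rowSum a n + sumTo n (λ k → α n k * a n k) ∎

rowSum-⊙ : LowerTriangular b → ∀ n → rowSum (a ⊙ b) n ≡ sumTo n (λ k → a n k * rowSum b k)
rowSum-⊙ {b} {a} b-low n = begin
  sumTo n (λ j → sumTo n (λ k → a n k * b k j))
    ≡⟨ sumTo-swap n n (λ j k → a n k * b k j) ⟩
  sumTo n (λ k → sumTo n (λ j → a n k * b k j))
    ≡⟨ sumTo-cong n (λ k → sumTo-*ˡ n (a n k) (b k)) ⟩
  sumTo n (λ k → a n k * sumTo n (b k))
    ≡⟨ sumTo-cong-≤ n (λ k≤n → cong (a n _ *_) (sumTo-extend n k≤n b-low)) ⟩
  sumTo n (λ k → a n k * rowSum b k) ∎

⊙-prev : ∀ n j → sumTo n (λ k → a n k * prev (b k) j) ≡ prev ((a ⊙ b) n) j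
⊙-prev {a} n zero    = sumTo-zero n (λ k → ℤₚ.*-zeroʳ (a n k))
⊙-prev     n (suc j) = refl

⊙-recurrent : Recurrent α a → Recurrent β b → (∀ n k j → α n k + β k j ≡ γ n j) →
  Recurrent γ (a ⊙ b)
⊙-recurrent {α} {a} {β} {b} {γ} ra rb α+β≡γ = record
  { initial = λ j → trans (cong (_* b 0 j) (initial ra 0))
                          (trans (ℤₚ.*-identityˡ (b 0 j)) (initial rb j))
  ; step    = step-⊙
  }
  where
  distrib : ∀ (p c x y : ℤ) → (p + c * x) * y ≡ p * y + c * (x * y)
  distrib = solve-∀

  distrib′ : ∀ (x p c y : ℤ) → x * (p + c * y) ≡ x * p + c * (x * y)
  distrib′ = solve-∀

  shifted : ∀ n j → sumTo (suc n) (λ k → prev (a n) k * b k j)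
                    ≡ prev ((a ⊙ b) n) j + sumTo n (λ k → β k j * (a n k * b k j))
  shifted n j = begin
    sumTo (suc n) (λ k → prev (a n) k * b k j)
      ≡⟨ trans (sumTo-shift n (λ k → prev (a n) k * b k j)) (ℤₚ.+-identityˡ _) ⟩
    sumTo n (λ k → a n k * b (suc k) j)
      ≡⟨ sumTo-cong n (λ k → trans (cong (a n k *_) (step rb k j))
                                   (distrib′ (a n k) (prev (b k) j) (β k j) (b k j))) ⟩
    sumTo n (λ k → a n k * prev (b k) j + β k j * (a n k * b k j))
      ≡⟨ sumTo-+ n (λ k → a n k * prev (b k) j) (λ k → β k j * (a n k * b k j)) ⟩
    sumTo n (λ k → a n k * prev (b k) j) + sumTo n (λ k → β k j * (a n k * b k j))
      ≡⟨ cong (_+ sumTo n (λ k → β k j * (a n k * b k j))) (⊙-prev {a} {b} n j) ⟩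
    prev ((a ⊙ b) n) j + sumTo n (λ k → β k j * (a n k * b k j)) ∎

  step-⊙ : ∀ n j → (a ⊙ b) (suc n) j ≡ prev ((a ⊙ b) n) j + γ n j * (a ⊙ b) n j
  step-⊙ n j = begin
    sumTo (suc n) (λ k → a (suc n) k * b k j)
      ≡⟨ sumTo-cong (suc n) (λ k → trans (cong (_* b k j) (step ra n k))
                                         (distrib (prev (a n) k) (α n k) (a n k) (b k j))) ⟩
    sumTo (suc n) (λ k → prev (a n) k * b k j + αab k)
      ≡⟨ sumTo-+ (suc n) (λ k → prev (a n) k * b k j) αab ⟩
    sumTo (suc n) (λ k → prev (a n) k * b k j) + sumTo (suc n) αab
      ≡⟨ cong₂ _+_ (shifted n j) (sumTo-extend (suc n) (ℕₚ.n≤1+n n) vanish) ⟩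
    (X + sumTo n βab) + sumTo n αab
      ≡⟨ trans (ℤₚ.+-assoc X (sumTo n βab) (sumTo n αab)) (cong (_+_ X) (sym (sumTo-+ n βab αab))) ⟩
    X + sumTo n (λ k → βab k + αab k)
      ≡⟨ cong (_+_ X) (sumTo-cong n combine) ⟩
    X + sumTo n (λ k → γ n j * (a n k * b k j))
      ≡⟨ cong (_+_ X) (sumTo-*ˡ n (γ n j) (λ k → a n k * b k j)) ⟩
    X + γ n j * (a ⊙ b) n j ∎
    where
    X : ℤ
    X = prev ((a ⊙ b) n) j
    αab βab : ℕ → ℤ
    αab k = α n k * (a n k * b k j)
    βab k = β k j * (a n k * b k j)
    vanish : ∀ {k} → n < k → αab k ≡ + 0
    vanish {k} n<k = trans (cong (λ x → α n k * (x * b k j)) (recurrent⇒lowerTriangular ra n<k))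
                           (ℤₚ.*-zeroʳ (α n k))
    combine : ∀ k → βab k + αab k ≡ γ n j * (a n k * b k j)
    combine k = trans (sym (ℤₚ.*-distribʳ-+ (a n k * b k j) (β k j) (α n k)))
                      (cong (_* (a n k * b k j)) (trans (ℤₚ.+-comm (β k j) (α n k)) (α+β≡γ n k j)))

alternate : (ℕ → ℕ → ℤ) → ℕ → ℕ → ℤ
alternate a n k = sign (n ∸ k) * a n k

sign-suc : ∀ m → sign (suc m) ≡ - sign m
sign-suc m = ℤₚ.-1*i≡-i (sign m)

sign-suc-∸ : ∀ n k (x : ℤ) → (n < k → x ≡ + 0) → sign (suc n ∸ k) * x ≡ - (sign (n ∸ k) * x)
sign-suc-∸ n       zero    x _   = trans (cong (_* x) (sign-suc n)) (sym (ℤₚ.neg-distribˡ-* (sign n) x))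
sign-suc-∸ zero    (suc k) x x≡0 rewrite x≡0 (s≤s z≤n) =
  trans (ℤₚ.*-zeroʳ (sign (0 ∸ k))) (cong -_ (sym (ℤₚ.*-zeroʳ (sign (0 ∸ suc k)))))
sign-suc-∸ (suc n) (suc k) x x≡0 = sign-suc-∸ n k x (λ n<k → x≡0 (s≤s n<k))

alternate-recurrent : Recurrent α a → Recurrent (λ n k → - α n k) (alternate a)
alternate-recurrent {α} {a} rec = record
  { initial = λ k → trans (cong₂ _*_ (cong sign (ℕₚ.0∸n≡0 k)) (initial rec k))
                          (ℤₚ.*-identityˡ (δ₀ k))
  ; step    = step-alt
  }
  where
  sign-prev : ∀ n k → sign (suc n ∸ k) * prev (a n) k ≡ prev (alternate a n) k
  sign-prev n zero    = ℤₚ.*-zeroʳ (sign (suc n))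
  sign-prev n (suc k) = refl

  pull : ∀ (s c x : ℤ) → s * (c * x) ≡ c * (s * x)
  pull = solve-∀

  sign-flip : ∀ n k → sign (suc n ∸ k) * (α n k * a n k) ≡ - α n k * alternate a n k
  sign-flip n k = begin
    sign (suc n ∸ k) * (α n k * a n k)    ≡⟨ pull (sign (suc n ∸ k)) (α n k) (a n k) ⟩
    α n k * (sign (suc n ∸ k) * a n k)
      ≡⟨ cong (α n k *_) (sign-suc-∸ n k (a n k) (recurrent⇒lowerTriangular rec)) ⟩
    α n k * - alternate a n k             ≡⟨ sym (ℤₚ.neg-distribʳ-* (α n k) (alternate a n k)) ⟩
    - (α n k * alternate a n k)           ≡⟨ ℤₚ.neg-distribˡ-* (α n k) (alternate a n k) ⟩
    - α n k * alternate a n k             ∎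

  step-alt : ∀ n k → alternate a (suc n) k ≡ prev (alternate a n) k + - α n k * alternate a n k
  step-alt n k = begin
    sign (suc n ∸ k) * a (suc n) k
      ≡⟨ cong (sign (suc n ∸ k) *_) (step rec n k) ⟩
    sign (suc n ∸ k) * (prev (a n) k + α n k * a n k)
      ≡⟨ ℤₚ.*-distribˡ-+ (sign (suc n ∸ k)) (prev (a n) k) (α n k * a n k) ⟩
    sign (suc n ∸ k) * prev (a n) k + sign (suc n ∸ k) * (α n k * a n k)
      ≡⟨ cong₂ _+_ (sign-prev n k) (sign-flip n k) ⟩
    prev (alternate a n) k + - α n k * alternate a n k ∎

S1-recurrent : Recurrent (λ n _ → - + n) S1
S1-recurrent = record { initial = initial-S1 ; step = step-S1 }
  where
  initial-S1 : ∀ k → S1 0 k ≡ δ₀ k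
  initial-S1 zero    = refl
  initial-S1 (suc k) = refl
  step-S1 : ∀ n k → S1 (suc n) k ≡ prev (S1 n) k + - + n * S1 n k
  step-S1 zero    zero    = refl
  step-S1 (suc n) zero    = sym (trans (ℤₚ.+-identityˡ _) (ℤₚ.*-zeroʳ (- + suc n)))
  step-S1 n       (suc k) = cong (_+_ (S1 n k)) (ℤₚ.neg-distribˡ-* (+ n) (S1 n (suc k)))

S2-recurrent : Recurrent (λ _ k → + k) S2
S2-recurrent = record { initial = initial-S2 ; step = step-S2 }
  where
  initial-S2 : ∀ k → S2 0 k ≡ δ₀ k
  initial-S2 zero    = refl
  initial-S2 (suc k) = refl
  step-S2 : ∀ n k → S2 (suc n) k ≡ prev (S2 n) k + + k * S2 n k
  step-S2 n zero    = refl
  step-S2 n (suc k) = refl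

Lah-recurrent : ∀ r → Recurrent (λ n k → + (n ℕ.+ k ℕ.+ 2 *ℕ r)) (Lah r)
Lah-recurrent r = record { initial = initial-Lah ; step = step-Lah }
  where
  initial-Lah : ∀ k → Lah r 0 k ≡ δ₀ k
  initial-Lah zero    = refl
  initial-Lah (suc k) = refl
  step-Lah : ∀ n k → Lah r (suc n) k ≡ prev (Lah r n) k + + (n ℕ.+ k ℕ.+ 2 *ℕ r) * Lah r n k
  step-Lah n zero    = trans (cong (λ m → + (m ℕ.+ 2 *ℕ r) * Lah r n 0) (sym (ℕₚ.+-identityʳ n)))
                             (sym (ℤₚ.+-identityˡ _))
  step-Lah n (suc k) = refl

binomial : ℕ → ℕ → ℤ
binomial n k = + (n C k)

binomial-recurrent : Recurrent (λ _ _ → + 1) binomial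
binomial-recurrent = record { initial = initial-C ; step = step-C }
  where
  initial-C : ∀ k → binomial 0 k ≡ δ₀ k
  initial-C zero    = refl
  initial-C (suc k) = refl
  step-C : ∀ n k → binomial (suc n) k ≡ prev (binomial n) k + + 1 * binomial n k
  step-C n zero    = refl
  step-C n (suc k) = begin
    + (suc n C suc k)            ≡⟨ cong +_ (sym (nCk+nC[k+1]≡[n+1]C[k+1] n k)) ⟩
    + (n C k ℕ.+ n C suc k)      ≡⟨ ℤₚ.pos-+ (n C k) (n C suc k) ⟩
    + (n C k) + + (n C suc k)    ≡⟨ cong (_+_ (+ (n C k))) (sym (ℤₚ.*-identityˡ (+ (n C suc k)))) ⟩
    + (n C k) + + 1 * + (n C suc k) ∎

≤ᵇ-suc-self : ∀ n → (suc n ℕ.≤ᵇ n) ≡ false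
≤ᵇ-suc-self zero    = refl
≤ᵇ-suc-self (suc n) = ≤ᵇ-suc-self n

bellUpTo-stable : ∀ r n {i} → i ≤ n → bellUpTo r n i ≡ Bell i r
bellUpTo-stable r zero    z≤n    = refl
bellUpTo-stable r (suc n) {i} i≤1+n with ℕₚ.m≤n⇒m<n∨m≡n i≤1+n
... | inj₂ refl      = refl
... | inj₁ (s≤s i≤n) rewrite Equivalence.to T-≡ (ℕₚ.≤⇒≤ᵇ i≤n) = bellUpTo-stable r n i≤n

Bell-suc : ∀ r n → Bell (suc n) r ≡ + r * Bell n r + sumTo n (λ j → binomial n j * Bell j r)
Bell-suc r n rewrite ≤ᵇ-suc-self n =
  cong (_+_ (+ r * Bell n r))
       (sumTo-cong-≤ n (λ {j} j≤n → cong (binomial n j *_) (bellUpTo-stable r n j≤n)))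

Bell-unique : ∀ r (u : ℕ → ℤ) → u 0 ≡ + 1 →
  (∀ n → u (suc n) ≡ + r * u n + sumTo n (λ j → binomial n j * u j)) → ∀ n → Bell n r ≡ u n
Bell-unique r u u₀ u-suc n = Bell≡u n ℕₚ.≤-refl
  where
  Bell≡u : ∀ n {i} → i ≤ n → Bell i r ≡ u i
  Bell≡u zero    z≤n   = sym u₀
  Bell≡u (suc n) i≤1+n with ℕₚ.m≤n⇒m<n∨m≡n i≤1+n
  ... | inj₁ (s≤s i≤n) = Bell≡u n i≤n
  ... | inj₂ refl      = begin
    Bell (suc n) r
      ≡⟨ Bell-suc r n ⟩
    + r * Bell n r + sumTo n (λ j → binomial n j * Bell j r)
      ≡⟨ cong₂ (λ x y → + r * x + y) (Bell≡u n ℕₚ.≤-refl)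
                                     (sumTo-cong-≤ n (λ {j} j≤n → cong (binomial n j *_) (Bell≡u n j≤n))) ⟩
    + r * u n + sumTo n (λ j → binomial n j * u j)
      ≡⟨ sym (u-suc n) ⟩
    u (suc n) ∎

-- rStirling₂ s n k is Broder's r-Stirling number {n+s, k+s}_s with r = s.
rStirling₂ : ℕ → ℕ → ℕ → ℤ
rStirling₂ s zero    k = δ₀ k
rStirling₂ s (suc n) k = prev (rStirling₂ s n) k + (+ k + + s) * rStirling₂ s n k

rStirling₂-recurrent : ∀ s → Recurrent (λ _ k → + k + + s) (rStirling₂ s)
rStirling₂-recurrent s = record { initial = λ _ → refl ; step = λ _ _ → refl }

binomial⊙rStirling₂ : ∀ s n j → (binomial ⊙ rStirling₂ s) n j ≡ rStirling₂ (suc s) n j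
binomial⊙rStirling₂ s = recurrent-unique
  (⊙-recurrent binomial-recurrent (rStirling₂-recurrent s) (λ _ _ j → shuffle (+ j) (+ s)))
  (rStirling₂-recurrent (suc s))
  where
  shuffle : ∀ (j s : ℤ) → + 1 + (j + s) ≡ j + (+ 1 + s)
  shuffle = solve-∀

rStirling₂-suc : ∀ s n j →
  rStirling₂ (suc s) n j ≡ rStirling₂ s n j + + suc j * rStirling₂ s n (suc j)
rStirling₂-suc s = recurrent-unique (rStirling₂-recurrent (suc s)) Q-recurrent
  where
  T = rStirling₂ s
  Q : ℕ → ℕ → ℤ
  Q n j = T n j + + suc j * T n (suc j)

  prev-Q : ∀ n j → prev (Q n) j ≡ prev (T n) j + + j * T n j
  prev-Q n zero    = refl
  prev-Q n (suc j) = refl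

  regroup : ∀ (p j s x y : ℤ) →
    (p + (j + s) * x) + (+ 1 + j) * (x + ((+ 1 + j) + s) * y)
    ≡ (p + j * x) + (j + (+ 1 + s)) * (x + (+ 1 + j) * y)
  regroup = solve-∀

  Q-recurrent : Recurrent (λ _ j → + j + + suc s) Q
  Q-recurrent = record
    { initial = λ j → trans (cong (_+_ (δ₀ j)) (ℤₚ.*-zeroʳ (+ suc j))) (ℤₚ.+-identityʳ (δ₀ j))
    ; step    = λ n j → trans (regroup (prev (T n) j) (+ j) (+ s) (T n j) (T n (suc j)))
                              (cong (_+ (+ j + + suc s) * Q n j) (sym (prev-Q n j)))
    }

rowSum-rStirling₂-suc : ∀ s n → rowSum (rStirling₂ s) (suc n)
  ≡ + s * rowSum (rStirling₂ s) n + sumTo n (λ i → binomial n i * rowSum (rStirling₂ s) i)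
rowSum-rStirling₂-suc s n = begin
  U (suc n)
    ≡⟨ recurrent-rowSum-suc (rStirling₂-recurrent s) n ⟩
  U n + sumTo n (λ j → (+ j + + s) * T n j)
    ≡⟨ cong (_+_ (U n)) (trans (sumTo-cong n (λ j → ℤₚ.*-distribʳ-+ (T n j) (+ j) (+ s)))
                               (sumTo-+ n (λ j → + j * T n j) (λ j → + s * T n j))) ⟩
  U n + (D + sumTo n (λ j → + s * T n j))
    ≡⟨ cong (λ x → U n + (D + x)) (sumTo-*ˡ n (+ s) (T n)) ⟩
  U n + (D + + s * U n)
    ≡⟨ regroup (U n) D (+ s * U n) ⟩
  + s * U n + (U n + D)
    ≡⟨ cong (_+_ (+ s * U n)) (sym binomial-transform) ⟩
  + s * U n + sumTo n (λ i → binomial n i * U i) ∎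
  where
  T = rStirling₂ s
  U = rowSum T
  D = sumTo n (λ j → + j * T n j)

  regroup : ∀ (u d su : ℤ) → u + (d + su) ≡ su + (u + d)
  regroup = solve-∀

  binomial-transform : sumTo n (λ i → binomial n i * U i) ≡ U n + D
  binomial-transform = begin
    sumTo n (λ i → binomial n i * U i)
      ≡⟨ sym (rowSum-⊙ {a = binomial} (recurrent⇒lowerTriangular (rStirling₂-recurrent s)) n) ⟩
    rowSum (binomial ⊙ T) n
      ≡⟨ sumTo-cong n (λ j → trans (binomial⊙rStirling₂ s n j) (rStirling₂-suc s n j)) ⟩
    sumTo n (λ j → T n j + + suc j * T n (suc j))
      ≡⟨ sumTo-+ n (T n) (λ j → + suc j * T n (suc j)) ⟩
    U n + sumTo n (λ j → + suc j * T n (suc j))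
      ≡⟨ cong (_+_ (U n)) (sumTo-unshift {λ j → + j * T n j} n refl
           (trans (cong (+ suc n *_) (recurrent⇒lowerTriangular (rStirling₂-recurrent s) (ℕₚ.n<1+n n)))
                  (ℤₚ.*-zeroʳ (+ suc n)))) ⟩
    U n + D ∎

Bell≡rowSum-rStirling₂ : ∀ s n → Bell n s ≡ rowSum (rStirling₂ s) n
Bell≡rowSum-rStirling₂ s = Bell-unique s (rowSum (rStirling₂ s)) refl (rowSum-rStirling₂-suc s)

pos-+₃ : ∀ a b c → + (a ℕ.+ b ℕ.+ c) ≡ + a + + b + + c
pos-+₃ a b c = trans (ℤₚ.pos-+ (a ℕ.+ b) c) (cong (_+ + c) (ℤₚ.pos-+ a b))

Lah≡alternateS1⊙rStirling₂ : ∀ r n j → Lah r n j ≡ (alternate S1 ⊙ rStirling₂ (2 *ℕ r)) n j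
Lah≡alternateS1⊙rStirling₂ r = recurrent-unique (Lah-recurrent r)
  (⊙-recurrent (alternate-recurrent S1-recurrent) (rStirling₂-recurrent s) weights)
  where
  s = 2 *ℕ r
  regroup : ∀ (n j s : ℤ) → - (- n) + (j + s) ≡ n + j + s
  regroup = solve-∀
  weights : ∀ n k j → - (- + n) + (+ j + + s) ≡ + (n ℕ.+ j ℕ.+ s)
  weights n _ j = trans (regroup (+ n) (+ j) (+ s)) (sym (pos-+₃ n j s))

rStirling₂≡alternateS2⊙Lah : ∀ r n j → rStirling₂ (2 *ℕ r) n j ≡ (alternate S2 ⊙ Lah r) n j
rStirling₂≡alternateS2⊙Lah r = recurrent-unique (rStirling₂-recurrent s)
  (⊙-recurrent (alternate-recurrent S2-recurrent) (Lah-recurrent r) weights)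
  where
  s = 2 *ℕ r
  cancel : ∀ (k j s : ℤ) → - k + (k + j + s) ≡ j + s
  cancel = solve-∀
  weights : ∀ n k j → - + k + + (k ℕ.+ j ℕ.+ s) ≡ + j + + s
  weights _ k j = trans (cong (_+_ (- + k)) (pos-+₃ k j s)) (cancel (+ k) (+ j) (+ s))

theorem6 : (n r : ℕ) →
    (LahBell n r ≡ sumTo n (λ k → sign (n ∸ k) * S1 n k * Bell k (2 *ℕ r)))
    × (Bell n (2 *ℕ r) ≡ sumTo n (λ k → sign (n ∸ k) * S2 n k * LahBell k r))
theorem6 n r = LahBell-expansion , Bell-expansion
  where
  s = 2 *ℕ r

  LahBell-expansion : LahBell n r ≡ sumTo n (λ k → alternate S1 n k * Bell k s)
  LahBell-expansion = begin
    rowSum (Lah r) n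
      ≡⟨ sumTo-cong n (Lah≡alternateS1⊙rStirling₂ r n) ⟩
    rowSum (alternate S1 ⊙ rStirling₂ s) n
      ≡⟨ rowSum-⊙ {a = alternate S1} (recurrent⇒lowerTriangular (rStirling₂-recurrent s)) n ⟩
    sumTo n (λ k → alternate S1 n k * rowSum (rStirling₂ s) k)
      ≡⟨ sumTo-cong n (λ k → cong (alternate S1 n k *_) (sym (Bell≡rowSum-rStirling₂ s k))) ⟩
    sumTo n (λ k → alternate S1 n k * Bell k s) ∎

  Bell-expansion : Bell n s ≡ sumTo n (λ k → alternate S2 n k * LahBell k r)
  Bell-expansion = begin
    Bell n s
      ≡⟨ Bell≡rowSum-rStirling₂ s n ⟩
    rowSum (rStirling₂ s) n
      ≡⟨ sumTo-cong n (rStirling₂≡alternateS2⊙Lah r n) ⟩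
    rowSum (alternate S2 ⊙ Lah r) n
      ≡⟨ rowSum-⊙ {a = alternate S2} (recurrent⇒lowerTriangular (Lah-recurrent r)) n ⟩
    sumTo n (λ k → alternate S2 n k * LahBell k r) ∎
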